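{- For every $n$-vertex Helly graph $G$, $diam(C(G))\le 2\sqrt{n}+3$.
   Context: Graphs are finite, connected, undirected and unweighted with shortest-path distance $d_G$. A graph is Helly if every family of pairwise intersecting balls $N^r[v]=\{u: d_G(u,v)\le r\}$ has a nonempty common intersection. The eccentricity of $v$ is $e_G(v)=\max_u d_G(u,v)$, the radius is $rad(G)=\min_v e_G(v)$, the center is $C(G)=\{v: e_G(v)=rad(G)\}$, and $diam(C(G))=\max_{u,v\in C(G)}d_G(u,v)$. -}

module Defs where

open import Data.Nat using (ℕ; zero; suc; _≤_; _∸_; _*_)
open import Data.Fin using (Fin)
open import Data.Bool using (Bool; true; false)
open import Data.Product using (Σ; ∃; _×_; _,_)
open import Relation.Binary.PropositionalEquality using (_≡_)

record Graph (n : ℕ) : Set where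
  field
    adj       : Fin n → Fin n → Bool
    adj-sym   : ∀ u v → adj u v ≡ adj v u
    adj-irrefl : ∀ u → adj u u ≡ false

module _ {n : ℕ} (G : Graph n) where
  open Graph G

  data Walk : Fin n → Fin n → ℕ → Set where
    []   : ∀ {u} → Walk u u 0
    step : ∀ {u w v k} → adj u w ≡ true → Walk w v k → Walk u v (suc k)

  Connected : Set
  Connected = ∀ u v → ∃ λ k → Walk u v k

  DistLe : Fin n → Fin n → ℕ → Set
  DistLe u v r = ∃ λ k → k ≤ r × Walk u v k

  Dist : Fin n → Fin n → ℕ → Set
  Dist u v k = Walk u v k × (∀ m → Walk u v m → k ≤ m)

  InBall : Fin n → ℕ → Fin n → Set
  InBall v r u = DistLe u v r

  Helly : Set₁
  Helly = (I : Set) (c : I → Fin n) (r : I → ℕ) →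
          (∀ i j → ∃ λ x → InBall (c i) (r i) x × InBall (c j) (r j) x) →
          ∃ λ x → ∀ i → InBall (c i) (r i) x

  Ecc : Fin n → ℕ → Set
  Ecc v e = (∀ u → ∃ λ k → Dist u v k × k ≤ e) × (∃ λ u → Dist u v e)

  Rad : ℕ → Set
  Rad r = (∃ λ v → Ecc v r) × (∀ v e → Ecc v e → r ≤ e)

  InCenter : Fin n → Set
  InCenter v = ∃ λ r → Rad r × Ecc v r

-- diam(C(G)) ≤ 2√n + 3, stated without reals:
-- for D ∈ ℕ, D ≤ 2√n + 3  ⇔  (D ∸ 3)² ≤ 4n.
CenterBound : ∀ {n} → Graph n → Set
CenterBound {n} G = ∀ u v k → InCenter G u → InCenter G v → Dist G u v k →
                    (k ∸ 3) * (k ∸ 3) ≤ 4 * n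

-- Let u, v be central vertices at distance K and r the radius. Helly graphs
-- have diameter at least 2r − 1, so there is a pair p, q with d(p,q) ≥ 2r − 1.
-- Put g = ⌊(K+1)/4⌋. For every (a, b) ∈ [0,2g)², the four balls
-- N[p] and N[q] of radii r − g + a and d(p,q) − (r − g + a), and N[u] and N[v]
-- of radii g + b and K − (g + b), pairwise intersect, since every vertex is
-- within r of u and of v. As the radii of each pair sum to its distance, a
-- common point x has d(x,p) = r − g + a and d(x,u) = g + b exactly, so these
-- 4g² points are distinct: 4g² ≤ n, and K − 3 ≤ 4g gives (K − 3)² ≤ 16g² ≤ 4n.
module Submission where

open import Defs
open import Data.Nat using (ℕ; zero; suc; _+_; _*_; _∸_; _≤_; _<_; z≤n; s≤s⁻¹; _≤?_)
open import Data.Nat.Properties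
open import Data.Nat.DivMod using (_/_; _%_; m≡m%n+[m/n]*n; m%n<n; m/n*n≤m)
open import Data.Nat.Induction using (<-rec)
open import Data.Nat.Tactic.RingSolver using (solve-∀)
open import Data.Fin using (Fin; toℕ; remQuot; combine) renaming (_≟_ to _≟ᶠ_)
open import Data.Fin.Properties using (any?; toℕ<n; toℕ-injective; combine-remQuot; injective⇒≤)
open import Data.Bool using (true)
import Data.Bool.Properties as Bool
open import Data.List using (allFin)
open import Data.List.Extrema.Nat using (argmax; f[xs]≤f[argmax])
open import Data.List.Relation.Unary.All using (lookup)
open import Data.List.Membership.Propositional.Properties using (∈-allFin)
open import Data.Product using (∃; ∃₂; _×_; _,_; proj₁; proj₂; uncurry)
open import Data.Empty using (⊥-elim)
open import Function using (_∘_)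
open import Relation.Nullary using (Dec; yes; no)
open import Relation.Nullary.Decidable using (map′; _×-dec_)
open import Relation.Unary using (Decidable)
open import Relation.Binary.PropositionalEquality

minimal : ∀ {P : ℕ → Set} → Decidable P → ∀ {k} → P k →
          ∃ λ m → P m × (∀ {j} → P j → m ≤ j)
minimal {P} P? {k} = <-rec (λ k → P k → ∃ λ m → P m × (∀ {j} → P j → m ≤ j)) search k
  where
  search : ∀ k → (∀ {m} → m < k → P m → ∃ λ m → P m × (∀ {j} → P j → m ≤ j)) →
         P k → ∃ λ m → P m × (∀ {j} → P j → m ≤ j)
  search k below pk with anyUpTo? P? k
  ... | yes (m , m<k , pm) = below m<k pm
  ... | no none            = k , pk , λ {j} pj → ≮⇒≥ λ j<k → none (j , j<k , pj)

injective₂⇒*≤ : ∀ {a b n} (F : Fin a → Fin b → Fin n) →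
                (∀ {x y x′ y′} → F x y ≡ F x′ y′ → x ≡ x′ × y ≡ y′) → a * b ≤ n
injective₂⇒*≤ {a} {b} F F-injective = injective⇒≤ {f = uncurry F ∘ remQuot b} injective
  where
  injective : ∀ {c c′} → uncurry F (remQuot {a} b c) ≡ uncurry F (remQuot {a} b c′) → c ≡ c′
  injective {c} {c′} eq with F-injective eq
  ... | eq₁ , eq₂ = begin
    c                                  ≡⟨ combine-remQuot {a} b c ⟨
    uncurry combine (remQuot {a} b c)  ≡⟨ cong₂ combine eq₁ eq₂ ⟩
    uncurry combine (remQuot {a} b c′) ≡⟨ combine-remQuot {a} b c′ ⟩
    c′                                 ∎
    where open ≡-Reasoning

window-complement : ∀ {c w a N} → a < w → c + w + c ≤ suc N → ∃ λ a′ → c + a + a′ ≡ N × c ≤ a′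
window-complement {c} {w} {a} {N} a<w bound with m≤n⇒∃[o]m+o≡n c+a+c≤N
  where
  c+a+c≤N : c + a + c ≤ N
  c+a+c≤N = s≤s⁻¹ (<-≤-trans (+-monoˡ-< c (+-monoʳ-< c a<w)) bound)
... | o , eq = c + o , trans (sym (+-assoc (c + a) c o)) eq , m≤m+n c o

-- 4g is written g + 2g + g, the shape window-complement takes with margin g.
quarter≤ : ∀ {g K} → g + (g + g) + g ≤ suc K → g ≤ K
quarter≤ {zero}  _     = z≤n
quarter≤ {suc g} bound = ≤-trans (m≤n+m (suc g) _) (s≤s⁻¹ bound)

quarter-bound : ∀ K n → (∀ g → g + (g + g) + g ≤ suc K → (g + g) * (g + g) ≤ n) →
                (K ∸ 3) * (K ∸ 3) ≤ 4 * n
quarter-bound K n grid = begin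
  (K ∸ 3) * (K ∸ 3)       ≤⟨ *-mono-≤ K∸3≤4g K∸3≤4g ⟩
  g * 4 * (g * 4)         ≡⟨ square-of-4g g ⟩
  4 * ((g + g) * (g + g)) ≤⟨ *-monoʳ-≤ 4 (grid g 4g≤1+K) ⟩
  4 * n                   ∎
  where
  open ≤-Reasoning
  g = suc K / 4
  four-g : ∀ g → g + (g + g) + g ≡ g * 4
  four-g = solve-∀
  4g≤1+K : g + (g + g) + g ≤ suc K
  4g≤1+K = ≤-trans (≤-reflexive (four-g g)) (m/n*n≤m (suc K) 4)
  square-of-4g : ∀ g → g * 4 * (g * 4) ≡ 4 * ((g + g) * (g + g))
  square-of-4g = solve-∀
  K≤3+4g : K ≤ 3 + g * 4
  K≤3+4g = ≤-trans (n≤1+n K) (s≤s⁻¹ (begin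
    suc (suc K)             ≡⟨ cong suc (m≡m%n+[m/n]*n (suc K) 4) ⟩
    suc (suc K % 4) + g * 4 ≤⟨ +-monoˡ-≤ (g * 4) (m%n<n (suc K) 4) ⟩
    4 + g * 4               ∎))
  K∸3≤4g : K ∸ 3 ≤ g * 4
  K∸3≤4g = m≤n+o⇒m∸n≤o K 3 K≤3+4g

module Metric {n : ℕ} (G : Graph n) (connected : Connected G) where
  open Graph G

  _++_ : ∀ {u w v a b} → Walk G u w a → Walk G w v b → Walk G u v (a + b)
  []       ++ q = q
  step e p ++ q = step e (p ++ q)

  reverse : ∀ {u v k} → Walk G u v k → Walk G v u k
  reverse []                         = []
  reverse (step {u = u} {w = w} e p) =
    subst (Walk G _ u) (+-comm _ 1) (reverse p ++ step (trans (adj-sym w u) e) [])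

  splitAt : ∀ a {b u v} → Walk G u v (a + b) → ∃ λ w → Walk G u w a × Walk G w v b
  splitAt zero    {u = u} p = u , [] , p
  splitAt (suc a) (step e p) with splitAt a p
  ... | w , p₁ , p₂ = w , step e p₁ , p₂

  walk? : ∀ k u v → Dec (Walk G u v k)
  walk? zero u v with u ≟ᶠ v
  ... | yes refl = yes []
  ... | no u≢v   = no λ { [] → u≢v refl }
  walk? (suc k) u v =
    map′ (λ (_ , e , p) → step e p) (λ { (step e p) → _ , e , p })
         (any? λ w → (adj u w Bool.≟ true) ×-dec walk? k w v)

  shortest : ∀ u v → ∃ λ k → Walk G u v k × (∀ {j} → Walk G u v j → k ≤ j)
  shortest u v = minimal (λ k → walk? k u v) (proj₂ (connected u v))

  dist : Fin n → Fin n → ℕ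
  dist u v = proj₁ (shortest u v)

  dist-walk : ∀ u v → Walk G u v (dist u v)
  dist-walk u v = proj₁ (proj₂ (shortest u v))

  dist-≤ : ∀ {u v k} → Walk G u v k → dist u v ≤ k
  dist-≤ {u} {v} = proj₂ (proj₂ (shortest u v))

  Dist-dist : ∀ u v → Dist G u v (dist u v)
  Dist-dist u v = dist-walk u v , λ _ → dist-≤

  Dist⇒≡dist : ∀ {u v k} → Dist G u v k → k ≡ dist u v
  Dist⇒≡dist (p , shortest) = ≤-antisym (shortest _ (dist-walk _ _)) (dist-≤ p)

  dist-refl : ∀ u → dist u u ≡ 0
  dist-refl u = n≤0⇒n≡0 (dist-≤ {u} [])

  dist-sym : ∀ u v → dist u v ≡ dist v u
  dist-sym u v = ≤-antisym (dist-≤ (reverse (dist-walk v u))) (dist-≤ (reverse (dist-walk u v)))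

  dist-triangle : ∀ u w v → dist u v ≤ dist u w + dist w v
  dist-triangle u w v = dist-≤ (dist-walk u w ++ dist-walk w v)

  DistLe⇒dist≤ : ∀ {u v r} → DistLe G u v r → dist u v ≤ r
  DistLe⇒dist≤ (k , k≤r , p) = ≤-trans (dist-≤ p) k≤r

  dist≤⇒balls-meet : ∀ {x y α β} → dist x y ≤ α + β → ∃ λ z → InBall G x α z × InBall G y β z
  dist≤⇒balls-meet {x} {y} {α} {β} d≤α+β with dist x y ≤? α
  ... | yes d≤α = y , (dist x y , d≤α , reverse (dist-walk x y)) , (0 , z≤n , [])
  ... | no  d≰α with splitAt α (subst (Walk G x y) (sym α+[d∸α]≡d) (dist-walk x y))
    where
    α+[d∸α]≡d : α + (dist x y ∸ α) ≡ dist x y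
    α+[d∸α]≡d = m+[n∸m]≡n (<⇒≤ (≰⇒> d≰α))
  ... | z , x→z , z→y = z , (α , ≤-refl , reverse x→z) , (dist x y ∸ α , d∸α≤β , z→y)
    where
    d∸α≤β : dist x y ∸ α ≤ β
    d∸α≤β = m≤n+o⇒m∸n≤o (dist x y) α d≤α+β

  dist-exact : ∀ {x y z α β} → α + β ≡ dist y z → dist x y ≤ α → dist x z ≤ β → dist x y ≡ α
  dist-exact {x} {y} {z} {α} {β} α+β≡d x∈y x∈z = ≤-antisym x∈y (+-cancelʳ-≤ β _ _ (begin
    α + β               ≡⟨ α+β≡d ⟩
    dist y z            ≤⟨ dist-triangle y x z ⟩
    dist y x + dist x z ≤⟨ +-mono-≤ (≤-reflexive (dist-sym y x)) x∈z ⟩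
    dist x y + β        ∎))
    where open ≤-Reasoning

  Ecc⇒dist≤ : ∀ {x e} → Ecc G x e → ∀ y → dist y x ≤ e
  Ecc⇒dist≤ (bounded , _) y with bounded y
  ... | k , d , k≤e = subst (_≤ _) (Dist⇒≡dist d) k≤e

  Ecc-exists : ∀ x → ∃ (Ecc G x)
  Ecc-exists x = dist farthest x , bounded , farthest , Dist-dist farthest x
    where
    farthest : Fin n
    farthest = argmax (λ y → dist y x) x (allFin n)
    bounded : ∀ y → ∃ λ k → Dist G y x k × k ≤ dist farthest x
    bounded y = dist y x , Dist-dist y x , lookup (f[xs]≤f[argmax] x (allFin n)) (∈-allFin y)

  Ecc≤ : ∀ {x e s} → Ecc G x e → (∀ y → dist y x ≤ s) → e ≤ s
  Ecc≤ (_ , y , d) x-central = subst (_≤ _) (sym (Dist⇒≡dist d)) (x-central y)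

  Rad⇒≤ : ∀ {r x s} → Rad G r → (∀ y → dist y x ≤ s) → r ≤ s
  Rad⇒≤ {x = x} (_ , minimum) x-central = ≤-trans (minimum x _ ecc) (Ecc≤ ecc x-central)
    where
    ecc : Ecc G x (proj₁ (Ecc-exists x))
    ecc = proj₂ (Ecc-exists x)

  InCenter⇒dist≤ : ∀ {r u} → Rad G r → InCenter G u → ∀ y → dist y u ≤ r
  InCenter⇒dist≤ (witness , _) (r′ , (_ , minimum′) , ecc) y =
    ≤-trans (Ecc⇒dist≤ ecc y) (minimum′ _ _ (proj₂ witness))

module HellyGraph {n : ℕ} (G : Graph n) (connected : Connected G) (helly : Helly G) where
  open Metric G connected

  helly-dist : ∀ {I : Set} (c : I → Fin n) (ρ : I → ℕ) → (∀ i j → dist (c i) (c j) ≤ ρ i + ρ j) →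
               ∃ λ x → ∀ i → dist x (c i) ≤ ρ i
  helly-dist c ρ close with helly _ c ρ (λ i j → dist≤⇒balls-meet (close i j))
  ... | x , x∈balls = x , λ i → DistLe⇒dist≤ (x∈balls i)

  -- Otherwise the balls of radius r − 1 around all vertices pairwise meet,
  -- and a common point would have eccentricity r − 1.
  diameter≥2rad∸1 : ∀ {r} → Rad G r → ∃₂ λ p q → r + r ≤ suc (dist p q)
  diameter≥2rad∸1 {zero}  ((x , _) , _) = x , x , z≤n
  diameter≥2rad∸1 {suc r} rad with any? (λ p → any? (λ q → suc r + suc r ≤? suc (dist p q)))
  ... | yes (p , q , far) = p , q , far
  ... | no  none with helly-dist (λ x → x) (λ _ → r) close
    where
    close : ∀ p q → dist p q ≤ r + r
    close p q with suc r + suc r ≤? suc (dist p q)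
    ... | yes far  = ⊥-elim (none (p , q , far))
    ... | no  ¬far = s≤s⁻¹ (≤-trans (s≤s⁻¹ (≰⇒> ¬far)) (≤-reflexive (+-suc r r)))
  ... | x , x-central = ⊥-elim (1+n≰n (Rad⇒≤ rad λ y → subst (_≤ r) (dist-sym x y) (x-central y)))

  private
    data Corner : Set where
      P Q U V : Corner

  four-ball-point : ∀ {p q u v i i′ j j′} → i + i′ ≡ dist p q → j + j′ ≡ dist u v →
                    dist p u ≤ i + j → dist p v ≤ i + j′ → dist q u ≤ i′ + j → dist q v ≤ i′ + j′ →
                    ∃ λ x → dist x p ≡ i × dist x u ≡ j
  four-ball-point {p} {q} {u} {v} {i} {i′} {j} {j′} i+i′≡d j+j′≡d pu pv qu qv
    with helly-dist centre radius close
    where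
    centre : Corner → Fin n
    centre P = p
    centre Q = q
    centre U = u
    centre V = v
    radius : Corner → ℕ
    radius P = i
    radius Q = i′
    radius U = j
    radius V = j′
    refl≤ : ∀ y α β → dist y y ≤ α + β
    refl≤ y α β = subst (_≤ α + β) (sym (dist-refl y)) z≤n
    swap : ∀ {y z} α β → dist y z ≤ α + β → dist z y ≤ β + α
    swap {y} {z} α β = subst₂ _≤_ (dist-sym y z) (+-comm α β)
    close : ∀ c c′ → dist (centre c) (centre c′) ≤ radius c + radius c′
    close P P = refl≤ p i i
    close P Q = ≤-reflexive (sym i+i′≡d)
    close P U = pu
    close P V = pv
    close Q P = swap i i′ (close P Q)
    close Q Q = refl≤ q i′ i′
    close Q U = qu
    close Q V = qv
    close U P = swap i j pu
    close U Q = swap i′ j qu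
    close U U = refl≤ u j j
    close U V = ≤-reflexive (sym j+j′≡d)
    close V P = swap i j′ pv
    close V Q = swap i′ j′ qv
    close V U = swap j j′ (close U V)
    close V V = refl≤ v j′ j′
  ... | x , x∈balls =
    x , dist-exact i+i′≡d (x∈balls P) (x∈balls Q) , dist-exact j+j′≡d (x∈balls U) (x∈balls V)

  centre-grid : ∀ {r u v g} → Rad G r → InCenter G u → InCenter G v →
                g + (g + g) + g ≤ suc (dist u v) → (g + g) * (g + g) ≤ n
  centre-grid {r} {u} {v} {g} rad u-central v-central u-window with diameter≥2rad∸1 rad
  ... | p , q , 2r≤d+1 = injective₂⇒*≤ point point-injective
    where
    near-u : ∀ y → dist y u ≤ r
    near-u = InCenter⇒dist≤ rad u-central
    near-v : ∀ y → dist y v ≤ r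
    near-v = InCenter⇒dist≤ rad v-central
    ρ = r ∸ g
    ρ+g≡r : ρ + g ≡ r
    ρ+g≡r = m∸n+n≡m (≤-trans (quarter≤ {g} u-window) (subst (_≤ r) (dist-sym v u) (near-u v)))
    rearrange : ∀ ρ g → (ρ + g) + (ρ + g) ≡ ρ + (g + g) + ρ
    rearrange = solve-∀
    p-window : ρ + (g + g) + ρ ≤ suc (dist p q)
    p-window = subst (_≤ suc (dist p q)) (trans (cong (λ r → r + r) (sym ρ+g≡r)) (rearrange ρ g)) 2r≤d+1
    cross : ∀ {y w α β} → dist y w ≤ r → ρ ≤ α → g ≤ β → dist y w ≤ α + β
    cross d≤r ρ≤α g≤β = ≤-trans d≤r (subst (_≤ _) ρ+g≡r (+-mono-≤ ρ≤α g≤β))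
    grid : (a b : Fin (g + g)) → ∃ λ x → dist x p ≡ ρ + toℕ a × dist x u ≡ g + toℕ b
    grid a b with window-complement (toℕ<n a) p-window | window-complement (toℕ<n b) u-window
    ... | i′ , i+i′≡d , ρ≤i′ | j′ , j+j′≡d , g≤j′ =
      four-ball-point i+i′≡d j+j′≡d
        (cross (near-u p) (m≤m+n ρ _) (m≤m+n g _)) (cross (near-v p) (m≤m+n ρ _) g≤j′)
        (cross (near-u q) ρ≤i′ (m≤m+n g _))        (cross (near-v q) ρ≤i′ g≤j′)
    point : Fin (g + g) → Fin (g + g) → Fin n
    point a b = proj₁ (grid a b)
    recover : ∀ {y c x x′} {a a′ : Fin (g + g)} →
              dist x y ≡ c + toℕ a → dist x′ y ≡ c + toℕ a′ → x ≡ x′ → a ≡ a′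
    recover {c = c} dx dx′ refl = toℕ-injective (+-cancelˡ-≡ c _ _ (trans (sym dx) dx′))
    point-injective : ∀ {a b a′ b′} → point a b ≡ point a′ b′ → a ≡ a′ × b ≡ b′
    point-injective {a} {b} {a′} {b′} eq =
      recover (proj₁ (proj₂ (grid a b))) (proj₁ (proj₂ (grid a′ b′))) eq ,
      recover (proj₂ (proj₂ (grid a b))) (proj₂ (proj₂ (grid a′ b′))) eq

corollary3 : (n : ℕ) (G : Graph n) → Connected G → Helly G → CenterBound G
corollary3 n G connected helly u v k u-central@(r , rad , _) v-central d≡k =
  subst (λ k → (k ∸ 3) * (k ∸ 3) ≤ 4 * n) (sym (Dist⇒≡dist d≡k))
        (quarter-bound (dist u v) n (λ g → centre-grid {g = g} rad u-central v-central))
  where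
  open Metric G connected
  open HellyGraph G connected helly
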